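{- Let $\lambda$ be a nonempty partition, let $A=\mathcal{D}(\lambda)$, and let $i,j\ge 1$ be integers such that $\lambda[i,j]$ is nonempty (so $A[i,j]$ is a position of Downright). Then $\mathbb{SG}(A[i-1,j-1])=\mathbb{SG}(A[i,j])$.
   Context: For a partition $\mu=(\mu_1,\dots,\mu_s)$ and nonnegative integers $i,j$, $\mu[i,j]$ is $(\mu_{i+1}-j,\mu_{i+2}-j,\dots)$ with nonpositive entries removed, if $i<s$ and $j<\mu_{i+1}$; otherwise $\mu[i,j]=()$. Downright $\mathcal{D}(\lambda)$: impartial normal-play game on nonempty partitions; from $\mu=(\mu_1,\dots,\mu_s)$ one may move to $\mu[1,0]$ if $s>1$ and to $\mu[0,1]$ if $\mu_1>1$. For nonempty $\lambda[i,j]$, $A[i,j]=\mathcal{D}(\lambda[i,j])$. $\mathbb{SG}$ is the Sprague--Grundy value, $\mathbb{SG}(A)=\operatorname{mex}\{\mathbb{SG}(B):A\to B\}$. -}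

module Defs where

open import Data.Nat using (ℕ; zero; suc; _+_; _∸_; _<_; _≥_; _<?_)
open import Data.Nat.Properties using (_≟_)
open import Data.List using (List; []; _∷_; drop; map; filter; length; _++_)
open import Data.Nat.ListAction using (sum)
open import Data.List.Membership.DecPropositional _≟_ using (_∈?_)
open import Data.List.Relation.Unary.All using (All)
open import Data.List.Relation.Unary.Linked using (Linked)
open import Relation.Nullary using (yes; no)

IsPartition : List ℕ → Set
IsPartition μ = All (0 <_) μ × Linked _≥_ μ
  where open import Data.Product using (_×_)

-- μ[i,j] : drop the first i parts, subtract j from the rest, remove nonpositive entries.
-- (If i ≥ s or j ≥ μ_{i+1} this is automatically the empty partition.)
shift : ℕ → ℕ → List ℕ → List ℕ
shift i j μ = map (λ x → x ∸ j) (filter (j <?_) (drop i μ))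

-- Options of a Downright position μ = (μ₁, …, μ_s):
-- μ[1,0] if s > 1, and μ[0,1] if μ₁ > 1.
moves : List ℕ → List (List ℕ)
moves [] = []
moves (x ∷ rest) = opt1 rest ++ opt2 (1 <? x)
  where
  opt1 : List ℕ → List (List ℕ)
  opt1 [] = []
  opt1 (y ∷ ys) = shift 1 0 (x ∷ rest) ∷ []
  opt2 : _ → List (List ℕ)
  opt2 (yes _) = shift 0 1 (x ∷ rest) ∷ []
  opt2 (no _) = []

mexFrom : ℕ → ℕ → List ℕ → ℕ
mexFrom zero n xs = n
mexFrom (suc k) n xs with n ∈? xs
... | yes _ = mexFrom k (suc n) xs
... | no _ = n

mex : List ℕ → ℕ
mex xs = mexFrom (suc (length xs)) 0 xs

-- Sprague–Grundy value, computed with fuel.  Every move removes at least one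
-- cell, so fuel = (number of cells) is always sufficient for partitions.
sgFuel : ℕ → List ℕ → ℕ
sgFuel zero μ = 0
sgFuel (suc k) μ = mex (mapSG (moves μ))
  where
  mapSG : List (List ℕ) → List ℕ
  mapSG [] = []
  mapSG (ν ∷ νs) = sgFuel k ν ∷ mapSG νs

SG : List ℕ → ℕ
SG μ = sgFuel (suc (sum μ)) μ

-- Write ν = μ[1,1]. Each option of μ, namely μ[1,0] and μ[0,1], has ν as an option
-- (ν = μ[1,0][0,1] = μ[0,1][1,0]), so no option of μ has value SG ν. Conversely the
-- options ν[1,0] and ν[0,1] of ν are μ[1,0][1,1] and μ[0,1][1,1], which by induction
-- have the values of μ[1,0] and μ[0,1]; so every value below SG ν is attained by an
-- option of μ, and SG μ = SG ν. The lemma is the case μ = λ[i-1,j-1], since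
-- λ[i-1,j-1][1,1] = λ[i,j].
module Submission where

open import Defs
open import Data.Nat using (ℕ; zero; suc; _+_; _∸_; _<_; _≤_; _≥_; _≤?_; _<?_; z≤n; s≤s; z<s)
open import Data.Nat.Properties
open import Data.Nat.ListAction using (sum)
open import Data.Fin using (toℕ)
open import Data.Fin.Properties using (toℕ<n; pigeonhole)
open import Data.List using (List; []; _∷_; drop; map; filter; length; lookup)
open import Data.List.Properties using (map-∘; map-cong; map-cong-local; drop-map; drop-drop; filter-accept; filter-reject; filter-none)
open import Data.List.Membership.Propositional using (_∈_; _∉_)
open import Data.List.Membership.Propositional.Properties using (∈-map⁺; ∈-map⁻; ∈-++⁺ʳ)
open import Data.List.Relation.Unary.Any using (here; there; index)
open import Data.List.Relation.Unary.Any.Properties using (lookup-index)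
open import Data.List.Relation.Unary.All as All using (All; _∷_)
import Data.List.Relation.Unary.All.Properties as All
open import Data.List.Relation.Unary.Linked as Linked using (Linked)
import Data.List.Relation.Unary.Linked.Properties as Linked
open import Data.Product using (_×_; _,_; proj₂; ∃-syntax)
open import Data.Sum using (_⊎_; inj₁; inj₂)
open import Function using (_∘_)
open import Relation.Nullary using (¬_; yes; no; contradiction)
open import Relation.Binary.PropositionalEquality
open import Relation.Binary.Definitions using (tri<; tri≈; tri>)
open import Data.List.Membership.DecPropositional _≟_ using (_∈?_)

initialSegment⊆⇒≤length : ∀ {n xs} → (∀ {k} → k < n → k ∈ xs) → n ≤ length xs
initialSegment⊆⇒≤length {n} {xs} segment⊆ with n ≤? length xs
... | yes n≤len = n≤len
... | no n≰len with pigeonhole (≰⇒> n≰len) (index ∘ segment⊆ ∘ toℕ<n)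
...   | i , j , i<j , same-index = contradiction i<j (<-irrefl toℕ-i≡toℕ-j)
  where
  toℕ-i≡toℕ-j = begin
    toℕ i ≡⟨ lookup-index (segment⊆ (toℕ<n i)) ⟩
    _     ≡⟨ cong (lookup xs) same-index ⟩
    _     ≡⟨ sym (lookup-index (segment⊆ (toℕ<n j))) ⟩
    toℕ j ∎
    where open ≡-Reasoning

mexFrom-below : ∀ f n xs → (∀ {k} → k < n → k ∈ xs) → ∀ {k} → k < mexFrom f n xs → k ∈ xs
mexFrom-below zero n xs below = below
mexFrom-below (suc f) n xs below with n ∈? xs
... | no _ = below
... | yes n∈ = mexFrom-below f (suc n) xs below′
  where
  below′ : ∀ {k} → k < suc n → k ∈ xs
  below′ k<1+n with m<1+n⇒m<n∨m≡n k<1+n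
  ... | inj₁ k<n = below k<n
  ... | inj₂ refl = n∈

mexFrom-∈ : ∀ f n xs → mexFrom f n xs ∈ xs → mexFrom f n xs ≡ n + f
mexFrom-∈ zero n xs _ = sym (+-identityʳ n)
mexFrom-∈ (suc f) n xs m∈ with n ∈? xs
... | no n∉ = contradiction m∈ n∉
... | yes _ = trans (mexFrom-∈ f (suc n) xs m∈) (sym (+-suc n f))

mex-minimal : ∀ xs {k} → k < mex xs → k ∈ xs
mex-minimal xs = mexFrom-below (suc (length xs)) 0 xs λ ()

-- The fuel suc (length xs) is enough: 0, …, length xs cannot all occur in xs.
mex-∉ : ∀ xs → mex xs ∉ xs
mex-∉ xs mex∈ = 1+n≰n (subst (_≤ length xs) (mexFrom-∈ _ 0 xs mex∈)
                         (initialSegment⊆⇒≤length (mex-minimal xs)))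

mex-unique : ∀ {xs m} → m ∉ xs → (∀ {k} → k < m → k ∈ xs) → mex xs ≡ m
mex-unique {xs} {m} m∉ below with <-cmp (mex xs) m
... | tri< mex<m _ _ = contradiction (below mex<m) (mex-∉ xs)
... | tri≈ _ mex≡m _ = mex≡m
... | tri> _ _ m<mex = contradiction (mex-minimal xs m<mex) m∉

linked-drop⁺ : ∀ {R : ℕ → ℕ → Set} n {xs} → Linked R xs → Linked R (drop n xs)
linked-drop⁺ zero l = l
linked-drop⁺ (suc n) {[]} l = l
linked-drop⁺ (suc n) {x ∷ xs} l = linked-drop⁺ n (Linked.tail l)

≥-trans : ∀ {a b c} → a ≥ b → b ≥ c → a ≥ c
≥-trans a≥b b≥c = ≤-trans b≥c a≥b

≮-head⇒≮-all : ∀ {j x xs} → Linked _≥_ (x ∷ xs) → ¬ j < x → All (λ y → ¬ j < y) (x ∷ xs)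
≮-head⇒≮-all l j≮x = All.map (λ y≤x j<y → j≮x (<-≤-trans j<y y≤x)) (Linked.Linked⇒All ≥-trans ≤-refl l)

-- On a weakly decreasing list the entries above j form a prefix, so keeping them commutes with drop.
drop-filter : ∀ n j {xs} → Linked _≥_ xs → drop n (filter (j <?_) xs) ≡ filter (j <?_) (drop n xs)
drop-filter zero j l = refl
drop-filter (suc n) j {[]} l = refl
drop-filter (suc n) j {x ∷ xs} l with j <? x
... | yes j<x rewrite filter-accept (j <?_) {x} {xs} j<x = drop-filter n j (Linked.tail l)
... | no j≮x rewrite filter-none (j <?_) (≮-head⇒≮-all l j≮x)
                   | filter-none (j <?_) (All.drop⁺ n (All.tail (≮-head⇒≮-all l j≮x)))
                   = refl

<∸⇒+< : ∀ {b j x} → b < x ∸ j → b + j < x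
<∸⇒+< {b} {j} b<x∸j = m≤o∸n⇒m+n≤o (suc b) (<⇒≤ (m∸n≢0⇒n<m (m<n⇒n≢0 b<x∸j))) b<x∸j

+<⇒<∸ : ∀ {b j x} → b + j < x → b < x ∸ j
+<⇒<∸ {b} = m+n≤o⇒m≤o∸n (suc b)

filter-map-∸ : ∀ b j xs →
  filter (b <?_) (map (_∸ j) (filter (j <?_) xs)) ≡ map (_∸ j) (filter (b + j <?_) xs)
filter-map-∸ b j [] = refl
filter-map-∸ b j (x ∷ xs) with j <? x | b + j <? x
... | no j≮x | _ rewrite filter-reject (j <?_) {x} {xs} j≮x
                      | filter-reject (b + j <?_) {x} {xs} (j≮x ∘ <-≤-trans (s≤s (m≤n+m j b)))
                      = filter-map-∸ b j xs
... | yes j<x | yes b+j<x rewrite filter-accept (j <?_) {x} {xs} j<x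
                               | filter-accept (b + j <?_) {x} {xs} b+j<x
                               | filter-accept (b <?_) {x ∸ j} {map (_∸ j) (filter (j <?_) xs)} (+<⇒<∸ b+j<x)
                               = cong (x ∸ j ∷_) (filter-map-∸ b j xs)
... | yes j<x | no b+j≮x rewrite filter-accept (j <?_) {x} {xs} j<x
                              | filter-reject (b + j <?_) {x} {xs} b+j≮x
                              | filter-reject (b <?_) {x ∸ j} {map (_∸ j) (filter (j <?_) xs)} (b+j≮x ∘ <∸⇒+<)
                              = filter-map-∸ b j xs

shift-shift : ∀ a b i j {xs} → Linked _≥_ xs → shift a b (shift i j xs) ≡ shift (a + i) (b + j) xs
shift-shift a b i j {xs} l = begin
  map (_∸ b) (filter (b <?_) (drop a (map (_∸ j) (filter (j <?_) (drop i xs)))))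
    ≡⟨ cong (map (_∸ b) ∘ filter (b <?_)) (drop-map a (filter (j <?_) (drop i xs))) ⟩
  map (_∸ b) (filter (b <?_) (map (_∸ j) (drop a (filter (j <?_) (drop i xs)))))
    ≡⟨ cong (map (_∸ b) ∘ filter (b <?_) ∘ map (_∸ j)) (drop-filter a j (linked-drop⁺ i l)) ⟩
  map (_∸ b) (filter (b <?_) (map (_∸ j) (filter (j <?_) (drop a (drop i xs)))))
    ≡⟨ cong (map (_∸ b)) (filter-map-∸ b j (drop a (drop i xs))) ⟩
  map (_∸ b) (map (_∸ j) (filter (b + j <?_) (drop a (drop i xs))))
    ≡⟨ sym (map-∘ _) ⟩
  map (λ x → x ∸ j ∸ b) (filter (b + j <?_) (drop a (drop i xs)))
    ≡⟨ map-cong (λ x → trans (∸-+-assoc x j b) (cong (x ∸_) (+-comm j b))) _ ⟩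
  map (_∸ (b + j)) (filter (b + j <?_) (drop a (drop i xs)))
    ≡⟨ cong (map (_∸ (b + j)) ∘ filter (b + j <?_)) (trans (drop-drop i a xs) (cong (λ n → drop n xs) (+-comm i a))) ⟩
  shift (a + i) (b + j) xs ∎
  where open ≡-Reasoning

shift-isPartition : ∀ i j {xs} → IsPartition xs → IsPartition (shift i j xs)
shift-isPartition i j {xs} (_ , l) =
    All.map⁺ (All.map m<n⇒0<n∸m (All.all-filter (j <?_) (drop i xs)))
  , Linked.map⁺ (Linked.filter⁺ (j <?_) ≥-trans (Linked.map (∸-monoˡ-≤ j) (linked-drop⁺ i l)))

shift-below-head : ∀ {j x} xs → Linked _≥_ (x ∷ xs) → ¬ j < x → shift 0 j (x ∷ xs) ≡ []
shift-below-head {j} xs l j≮x = cong (map (_∸ j)) (filter-none (j <?_) (≮-head⇒≮-all l j≮x))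

shift-≢[] : ∀ {j x} xs → j < x → shift 0 j (x ∷ xs) ≢ []
shift-≢[] {j} {x} xs j<x rewrite filter-accept (j <?_) {x} {xs} j<x = λ ()

∈-moves⁻ : ∀ {μ ν} → IsPartition μ → ν ∈ moves μ → ν ≢ [] × (ν ≡ shift 1 0 μ ⊎ ν ≡ shift 0 1 μ)
∈-moves⁻ {x ∷ rest} p ν∈ with 1 <? x
∈-moves⁻ {x ∷ []} _ (here refl) | yes 1<x = shift-≢[] [] 1<x , inj₂ refl
∈-moves⁻ {x ∷ y ∷ ys} (_ ∷ 0<y ∷ _ , _) (here refl) | yes _ = shift-≢[] ys 0<y , inj₁ refl
∈-moves⁻ {x ∷ y ∷ ys} _ (there (here refl)) | yes 1<x = shift-≢[] (y ∷ ys) 1<x , inj₂ refl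
∈-moves⁻ {x ∷ y ∷ ys} (_ ∷ 0<y ∷ _ , _) (here refl) | no _ = shift-≢[] ys 0<y , inj₁ refl

∈-moves⁺ : ∀ {μ ν} → IsPartition μ → ν ≢ [] → ν ≡ shift 1 0 μ ⊎ ν ≡ shift 0 1 μ → ν ∈ moves μ
∈-moves⁺ {[]} _ ν≢[] (inj₁ refl) = contradiction refl ν≢[]
∈-moves⁺ {[]} _ ν≢[] (inj₂ refl) = contradiction refl ν≢[]
∈-moves⁺ {x ∷ []} _ ν≢[] (inj₁ refl) = contradiction refl ν≢[]
∈-moves⁺ {x ∷ y ∷ ys} _ _ (inj₁ refl) = here refl
∈-moves⁺ {x ∷ rest} (_ , l) ν≢[] (inj₂ refl) with 1 <? x
... | yes _ = ∈-++⁺ʳ _ (here refl)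
... | no 1≮x = contradiction (shift-below-head rest l 1≮x) ν≢[]

moves-isPartition : ∀ {μ ν} → IsPartition μ → ν ∈ moves μ → IsPartition ν
moves-isPartition p ν∈ with ∈-moves⁻ p ν∈
... | _ , inj₁ refl = shift-isPartition 1 0 p
... | _ , inj₂ refl = shift-isPartition 0 1 p

sum-shift-≤ : ∀ i j xs → sum (shift i j xs) ≤ sum xs
sum-shift-≤ zero j [] = z≤n
sum-shift-≤ zero j (x ∷ xs) with j <? x
... | yes j<x rewrite filter-accept (j <?_) {x} {xs} j<x = +-mono-≤ (m∸n≤m x j) (sum-shift-≤ zero j xs)
... | no j≮x rewrite filter-reject (j <?_) {x} {xs} j≮x = ≤-trans (sum-shift-≤ zero j xs) (m≤n+m (sum xs) x)
sum-shift-≤ (suc i) j [] = z≤n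
sum-shift-≤ (suc i) j (x ∷ xs) = ≤-trans (sum-shift-≤ i j xs) (m≤n+m (sum xs) x)

moves-sum< : ∀ {μ ν} → IsPartition μ → ν ∈ moves μ → sum ν < sum μ
moves-sum< {x ∷ xs} p@(0<x ∷ _ , l) ν∈ with ∈-moves⁻ p ν∈
... | _ , inj₁ refl = ≤-<-trans (sum-shift-≤ 0 0 xs) (m<n+m (sum xs) 0<x)
... | ν≢[] , inj₂ refl with 1 <? x
...   | yes 1<x rewrite filter-accept (1 <?_) {x} {xs} 1<x = +-mono-<-≤ (∸-monoʳ-< z<s 0<x) (sum-shift-≤ 0 1 xs)
...   | no 1≮x = contradiction (shift-below-head xs l 1≮x) ν≢[]

sgFuel-suc : ∀ k μ → sgFuel (suc k) μ ≡ mex (map (sgFuel k) (moves μ))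
sgFuel-suc k [] = refl
sgFuel-suc k (x ∷ rest) with 1 <? x
sgFuel-suc k (x ∷ []) | yes _ = refl
sgFuel-suc k (x ∷ []) | no _ = refl
sgFuel-suc k (x ∷ y ∷ ys) | yes _ = refl
sgFuel-suc k (x ∷ y ∷ ys) | no _ = refl

sgFuel-stable : ∀ {k m μ} → IsPartition μ → sum μ < k → sum μ < m → sgFuel k μ ≡ sgFuel m μ
sgFuel-stable {suc k} {suc m} {μ} p (s≤s μ≤k) (s≤s μ≤m) = begin
  sgFuel (suc k) μ                ≡⟨ sgFuel-suc k μ ⟩
  mex (map (sgFuel k) (moves μ))  ≡⟨ cong mex (map-cong-local (All.tabulate options-stable)) ⟩
  mex (map (sgFuel m) (moves μ))  ≡⟨ sym (sgFuel-suc m μ) ⟩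
  sgFuel (suc m) μ                ∎
  where
  open ≡-Reasoning
  options-stable : ∀ {ν} → ν ∈ moves μ → sgFuel k ν ≡ sgFuel m ν
  options-stable ν∈ = sgFuel-stable (moves-isPartition p ν∈)
    (<-≤-trans (moves-sum< p ν∈) μ≤k) (<-≤-trans (moves-sum< p ν∈) μ≤m)

SG-unfold : ∀ {μ} → IsPartition μ → SG μ ≡ mex (map SG (moves μ))
SG-unfold {μ} p = trans (sgFuel-suc (sum μ) μ) (cong mex (map-cong-local (All.tabulate options-stable)))
  where
  options-stable : ∀ {ν} → ν ∈ moves μ → sgFuel (sum μ) ν ≡ SG ν
  options-stable ν∈ = sgFuel-stable (moves-isPartition p ν∈) (moves-sum< p ν∈) (n<1+n _)

SG-option-≢ : ∀ {μ ν} → IsPartition μ → ν ∈ moves μ → SG ν ≢ SG μ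
SG-option-≢ {μ} p ν∈ SGν≡SGμ =
  mex-∉ (map SG (moves μ)) (subst (_∈ map SG (moves μ)) (trans SGν≡SGμ (SG-unfold p)) (∈-map⁺ SG ν∈))

SG-option-below : ∀ {μ k} → IsPartition μ → k < SG μ → ∃[ ν ] ν ∈ moves μ × SG ν ≡ k
SG-option-below {μ} p k<SGμ with ∈-map⁻ SG (mex-minimal (map SG (moves μ)) (subst (_ <_) (SG-unfold p) k<SGμ))
... | ν , ν∈ , k≡SGν = ν , ν∈ , sym k≡SGν

SG-unique : ∀ {μ m} → IsPartition μ → (∀ {ν} → ν ∈ moves μ → SG ν ≢ m) →
            (∀ {k} → k < m → ∃[ ν ] ν ∈ moves μ × SG ν ≡ k) → SG μ ≡ m
SG-unique {μ} {m} p options≢ below = trans (SG-unfold p) (mex-unique m∉ k∈)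
  where
  m∉ : m ∉ map SG (moves μ)
  m∉ m∈ with ∈-map⁻ SG m∈
  ... | ν , ν∈ , m≡SGν = options≢ ν∈ (sym m≡SGν)
  k∈ : ∀ {k} → k < m → k ∈ map SG (moves μ)
  k∈ k<m with below k<m
  ... | ν , ν∈ , refl = ∈-map⁺ SG ν∈

SG-shift11-step : ∀ {μ} → IsPartition μ → shift 1 1 μ ≢ [] →
                  (∀ {ω} → ω ∈ moves μ → shift 1 1 ω ≢ [] → SG ω ≡ SG (shift 1 1 ω)) →
                  SG μ ≡ SG (shift 1 1 μ)
SG-shift11-step {μ} p@(_ , l) ν≢[] ih = SG-unique p options≢ below
  where
  ν : List ℕ
  ν = shift 1 1 μ
  pν : IsPartition ν
  pν = shift-isPartition 1 1 p
  pD : IsPartition (shift 1 0 μ)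
  pD = shift-isPartition 1 0 p
  pR : IsPartition (shift 0 1 μ)
  pR = shift-isPartition 0 1 p

  D[0,1]≡ν : shift 0 1 (shift 1 0 μ) ≡ ν
  D[0,1]≡ν = shift-shift 0 1 1 0 l
  R[1,0]≡ν : shift 1 0 (shift 0 1 μ) ≡ ν
  R[1,0]≡ν = shift-shift 1 0 0 1 l
  D[1,1]≡ν[1,0] : shift 1 1 (shift 1 0 μ) ≡ shift 1 0 ν
  D[1,1]≡ν[1,0] = trans (shift-shift 1 1 1 0 l) (sym (shift-shift 1 0 1 1 l))
  R[1,1]≡ν[0,1] : shift 1 1 (shift 0 1 μ) ≡ shift 0 1 ν
  R[1,1]≡ν[0,1] = trans (shift-shift 1 1 0 1 l) (sym (shift-shift 0 1 1 1 l))

  D∈ : shift 1 0 μ ∈ moves μ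
  D∈ = ∈-moves⁺ p (λ D≡[] → ν≢[] (trans (sym D[0,1]≡ν) (cong (shift 0 1) D≡[]))) (inj₁ refl)
  R∈ : shift 0 1 μ ∈ moves μ
  R∈ = ∈-moves⁺ p (λ R≡[] → ν≢[] (trans (sym R[1,0]≡ν) (cong (shift 1 0) R≡[]))) (inj₂ refl)

  options≢ : ∀ {ω} → ω ∈ moves μ → SG ω ≢ SG ν
  options≢ ω∈ with ∈-moves⁻ p ω∈
  ... | _ , inj₁ refl = ≢-sym (SG-option-≢ pD (∈-moves⁺ pD ν≢[] (inj₂ (sym D[0,1]≡ν))))
  ... | _ , inj₂ refl = ≢-sym (SG-option-≢ pR (∈-moves⁺ pR ν≢[] (inj₁ (sym R[1,0]≡ν))))

  ih-via : ∀ {ω ρ} → ω ∈ moves μ → shift 1 1 ω ≡ ρ → ρ ≢ [] → SG ω ≡ SG ρ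
  ih-via ω∈ ω[1,1]≡ρ ρ≢[] = trans (ih ω∈ (ρ≢[] ∘ trans (sym ω[1,1]≡ρ))) (cong SG ω[1,1]≡ρ)

  below : ∀ {k} → k < SG ν → ∃[ ω ] ω ∈ moves μ × SG ω ≡ k
  below k<SGν with SG-option-below pν k<SGν
  ... | ρ , ρ∈ , SGρ≡k with ∈-moves⁻ pν ρ∈
  ...   | ρ≢[] , inj₁ refl = shift 1 0 μ , D∈ , trans (ih-via D∈ D[1,1]≡ν[1,0] ρ≢[]) SGρ≡k
  ...   | ρ≢[] , inj₂ refl = shift 0 1 μ , R∈ , trans (ih-via R∈ R[1,1]≡ν[0,1] ρ≢[]) SGρ≡k

SG-shift11 : ∀ {μ} → IsPartition μ → shift 1 1 μ ≢ [] → SG μ ≡ SG (shift 1 1 μ)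
SG-shift11 {μ} = bounded (suc (sum μ)) ≤-refl
  where
  bounded : ∀ n {μ} → sum μ < n → IsPartition μ → shift 1 1 μ ≢ [] → SG μ ≡ SG (shift 1 1 μ)
  bounded (suc n) (s≤s μ≤n) p ν≢[] = SG-shift11-step p ν≢[] λ ω∈ →
    bounded n (<-≤-trans (moves-sum< p ω∈) μ≤n) (moves-isPartition p ω∈)

lemma4p4 : (lam : List ℕ) → IsPartition lam → lam ≢ [] →
    (i j : ℕ) → 1 ≤ i → 1 ≤ j → shift i j lam ≢ [] →
    SG (shift (i ∸ 1) (j ∸ 1) lam) ≡ SG (shift i j lam)
lemma4p4 lam p _ (suc i) (suc j) _ _ nonempty =
  trans (SG-shift11 (shift-isPartition i j p) (nonempty ∘ trans (sym hook))) (cong SG hook)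
  where
  hook : shift 1 1 (shift i j lam) ≡ shift (suc i) (suc j) lam
  hook = shift-shift 1 1 i j (proj₂ p)
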